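{- Let $n \ge 1$ and let $i = \frac{3^n+1}{2} + \frac{3^j-1}{2} + \frac{3^k-1}{2}$, where $0 \le j \le k \le n-1$ are integers. Then $$(-1)^{i - \frac{3^n+1}{2}} \binom{3i - \frac{3^n-1}{2}}{i - \frac{3^n+1}{2}} \equiv \begin{cases} 1 \pmod 3 & \text{if } j = k, \\ (-1)^{j+k+1} \pmod 3 & \text{if } j < k. \end{cases}$$ -}

module Defs where

open import Data.Nat using (ℕ; _+_; _*_; _∸_; _^_; _/_)
open import Data.Integer using (ℤ; +_; -_; _-_) renaming (_*_ to _*ℤ_)
open import Data.Integer.Divisibility using (_∣_)

neg1^ : ℕ → ℤ
neg1^ ℕ.zero = + 1
neg1^ (ℕ.suc e) = - (neg1^ e)

_≡_[mod_] : ℤ → ℤ → ℕ → Set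
a ≡ b [mod m ] = (+ m) ∣ (a - b)

-- i = (3^n+1)/2 + (3^j-1)/2 + (3^k-1)/2  (exact divisions since 3^x is odd)
idx : ℕ → ℕ → ℕ → ℕ
idx n j k = ((3 ^ n + 1) / 2) + ((3 ^ j ∸ 1) / 2) + ((3 ^ k ∸ 1) / 2)

-- Write ones k = (3^k − 1)/2 for the base-3 repunit and d ∷₃ x = d + 3x. With n + 1 in place of n,
-- the binomial of the theorem is C(2 ∷₃ (3^n + Q), Q) where Q = ones j + ones k has j lowest base-3
-- digits 2 followed by k − j digits 1. Its top is Q shifted up one place behind a digit 2, so Lucas'
-- theorem pairs each digit of Q with the digit below it: the factors are C(2,2) = 1 for the twos,
-- C(2,1) = 2 at the first one (present iff j < k), and 1 beyond. Hence the binomial is 1 or 2 ≡ −1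
-- modulo 3, and the sign is (−1)^Q = (−1)^(j+k) because ones k ≡ k (mod 2).

module Submission where

open import Data.Nat
  using (ℕ; zero; suc; _+_; _*_; _∸_; _^_; _/_; _≤_; _<_; s≤s; z≤n; s<s⁻¹)
open import Data.Nat.Properties
  using (+-comm; +-assoc; +-suc; +-identityʳ; <⇒≤; n<1+n; m+n∸m≡n; m+n∸n≡m; m+[n∸m]≡n; ^-distribˡ-+-*)
open import Data.Nat.DivMod using (m*n/n≡m)
open import Data.Nat.Divisibility as ℕ using (divides; _∣0)
open import Data.Nat.Combinatorics using (_C_; nCk+nC[k+1]≡[n+1]C[k+1]; k>n⇒nCk≡0; nCn≡1)
open import Data.Nat.Tactic.RingSolver using (solve-∀)
open import Data.Integer using (ℤ; +_; -_; 0ℤ)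
  renaming (_+_ to _+ℤ_; _-_ to _-ℤ_; _*_ to _*ℤ_)
import Data.Integer.Properties as ℤ
import Data.Integer.Tactic.RingSolver as ℤ-Solver
open import Data.Integer.Divisibility.Signed
  using (∣ᵤ⇒∣; ∣⇒∣ᵤ; ∣m∣n⇒∣m+n; ∣m⇒∣-m; ∣n⇒∣m*n)
  renaming (_∣_ to _∣ˢ_)
open import Data.Product using (_×_; _,_)
open import Level using (0ℓ)
open import Relation.Binary.Bundles using (Setoid)
import Relation.Binary.Reasoning.Setoid as SetoidReasoning
open import Relation.Binary.PropositionalEquality
  using (_≡_; refl; sym; trans; cong; cong₂; module ≡-Reasoning)
open import Defs

-- Defs' congruence wrapped in a record, so that Agda can infer the two related integers.
infix 4 _≈_[mod_]
record _≈_[mod_] (x y : ℤ) (m : ℕ) : Set where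
  constructor mk≈
  field ≈⇒≡ : x ≡ y [mod m ]
open _≈_[mod_] public

module _ {m : ℕ} where

  private
    ≈-by : ∀ {x y e} → e ≡ x -ℤ y → + m ∣ˢ e → x ≈ y [mod m ]
    ≈-by refl m∣e = mk≈ (∣⇒∣ᵤ m∣e)

    ∣-difference : ∀ {x y} → x ≈ y [mod m ] → + m ∣ˢ x -ℤ y
    ∣-difference (mk≈ m∣x-y) = ∣ᵤ⇒∣ m∣x-y

  mod-reflexive : ∀ {x y} → x ≡ y → x ≈ y [mod m ]
  mod-reflexive {x} refl = ≈-by (sym (ℤ.+-inverseʳ x)) (∣ᵤ⇒∣ (m ∣0))

  mod-sym : ∀ {x y} → x ≈ y [mod m ] → y ≈ x [mod m ]
  mod-sym {x} {y} x≈y = ≈-by (identity x y) (∣m⇒∣-m (∣-difference x≈y))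
    where
    identity : ∀ x y → - (x -ℤ y) ≡ y -ℤ x
    identity = ℤ-Solver.solve-∀

  mod-trans : ∀ {x y z} → x ≈ y [mod m ] → y ≈ z [mod m ] → x ≈ z [mod m ]
  mod-trans {x} {y} {z} x≈y y≈z =
    ≈-by (identity x y z) (∣m∣n⇒∣m+n (∣-difference x≈y) (∣-difference y≈z))
    where
    identity : ∀ x y z → (x -ℤ y) +ℤ (y -ℤ z) ≡ x -ℤ z
    identity = ℤ-Solver.solve-∀

  mod-+-cong : ∀ {x y u v} → x ≈ y [mod m ] → u ≈ v [mod m ] → x +ℤ u ≈ y +ℤ v [mod m ]
  mod-+-cong {x} {y} {u} {v} x≈y u≈v =
    ≈-by (identity x y u v) (∣m∣n⇒∣m+n (∣-difference x≈y) (∣-difference u≈v))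
    where
    identity : ∀ x y u v → (x -ℤ y) +ℤ (u -ℤ v) ≡ (x +ℤ u) -ℤ (y +ℤ v)
    identity = ℤ-Solver.solve-∀

  mod-*-congˡ : ∀ x {u v} → u ≈ v [mod m ] → x *ℤ u ≈ x *ℤ v [mod m ]
  mod-*-congˡ x {u} {v} u≈v = ≈-by (identity x u v) (∣n⇒∣m*n x (∣-difference u≈v))
    where
    identity : ∀ x u v → x *ℤ (u -ℤ v) ≡ x *ℤ u -ℤ x *ℤ v
    identity = ℤ-Solver.solve-∀

  ∣⇒≈0 : ∀ {n} → m ℕ.∣ n → + n ≈ 0ℤ [mod m ]
  ∣⇒≈0 {n} m∣n = ≈-by (sym (ℤ.+-identityʳ (+ n))) (∣ᵤ⇒∣ {+ m} {+ n} m∣n)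

mod-setoid : ℕ → Setoid 0ℓ 0ℓ
mod-setoid m = record
  { Carrier       = ℤ
  ; _≈_           = λ x y → x ≈ y [mod m ]
  ; isEquivalence = record { refl = mod-reflexive refl ; sym = mod-sym ; trans = mod-trans }
  }

module ModReasoning (m : ℕ) = SetoidReasoning (mod-setoid m)

pascal : ∀ n k → + (suc n C suc k) ≡ + (n C k) +ℤ + (n C suc k)
pascal n k = cong +_ (sym (nCk+nC[k+1]≡[n+1]C[k+1] n k))

*-pascal : ∀ x n k → x *ℤ + (n C k) +ℤ x *ℤ + (n C suc k) ≡ x *ℤ + (suc n C suc k)
*-pascal x n k = trans (sym (ℤ.*-distribˡ-+ x _ _)) (cong (x *ℤ_) (sym (pascal n k)))

-- The hypothesis on row p of Pascal's triangle, which
-- holds for every prime p, is the only property of p that the Pascal-rule induction on (A, r) needs.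
lucas : ∀ {p} → (∀ {k} → 0 < k → k < p → p ℕ.∣ p C k) →
        ∀ r s A D → r < p → s < p →
        + ((r + A * p) C (s + D * p)) ≈ + (A C D) *ℤ + (r C s) [mod p ]
lucas {suc q} row r zero A zero _ _ = mod-reflexive refl
lucas {suc q} row zero (suc s) zero D _ _ = mod-reflexive (sym (ℤ.*-zeroʳ (+ (0 C D))))
lucas {suc q} row zero zero zero (suc D) _ _ = mod-reflexive refl
lucas {suc q} row (suc r) (suc s) A D r<p s<p = begin
  + (suc (r + A * p) C suc (s + D * p))
    ≡⟨ pascal (r + A * p) (s + D * p) ⟩
  + ((r + A * p) C (s + D * p)) +ℤ + ((r + A * p) C (suc s + D * p))
    ≈⟨ mod-+-cong (lucas row r s A D (<⇒≤ r<p) (<⇒≤ s<p)) (lucas row r (suc s) A D (<⇒≤ r<p) s<p) ⟩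
  + (A C D) *ℤ + (r C s) +ℤ + (A C D) *ℤ + (r C suc s)
    ≡⟨ *-pascal (+ (A C D)) r s ⟩
  + (A C D) *ℤ + (suc r C suc s) ∎
  where p = suc q; open ModReasoning p
lucas {suc q} row (suc r) zero A (suc D) r<p _ = begin
  + (suc (r + A * p) C suc (q + D * p))
    ≡⟨ pascal (r + A * p) (q + D * p) ⟩
  + ((r + A * p) C (q + D * p)) +ℤ + ((r + A * p) C (suc q + D * p))
    ≈⟨ mod-+-cong (lucas row r q A D (<⇒≤ r<p) (n<1+n q)) (lucas row r zero A (suc D) (<⇒≤ r<p) (s≤s z≤n)) ⟩
  + (A C D) *ℤ + (r C q) +ℤ + (A C suc D) *ℤ + 1
    ≡⟨ cong (λ c → + (A C D) *ℤ + c +ℤ + (A C suc D) *ℤ + 1) (k>n⇒nCk≡0 (s<s⁻¹ r<p)) ⟩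
  + (A C D) *ℤ 0ℤ +ℤ + (A C suc D) *ℤ + 1
    ≡⟨ cong (_+ℤ + (A C suc D) *ℤ + 1) (ℤ.*-zeroʳ (+ (A C D))) ⟩
  0ℤ +ℤ + (A C suc D) *ℤ + 1
    ≡⟨ ℤ.+-identityˡ _ ⟩
  + (A C suc D) *ℤ + 1 ∎
  where p = suc q; open ModReasoning p
lucas {suc q} row zero (suc s) (suc A) D _ s<p = begin
  + (suc (q + A * p) C suc (s + D * p))
    ≡⟨ pascal (q + A * p) (s + D * p) ⟩
  + ((q + A * p) C (s + D * p)) +ℤ + ((q + A * p) C (suc s + D * p))
    ≈⟨ mod-+-cong (lucas row q s A D (n<1+n q) (<⇒≤ s<p)) (lucas row q (suc s) A D (n<1+n q) s<p) ⟩
  + (A C D) *ℤ + (q C s) +ℤ + (A C D) *ℤ + (q C suc s)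
    ≡⟨ *-pascal (+ (A C D)) q s ⟩
  + (A C D) *ℤ + (p C suc s)
    ≈⟨ mod-*-congˡ (+ (A C D)) (∣⇒≈0 (row (s≤s z≤n) s<p)) ⟩
  + (A C D) *ℤ 0ℤ
    ≡⟨ ℤ.*-zeroʳ (+ (A C D)) ⟩
  0ℤ
    ≡⟨ ℤ.*-zeroʳ (+ (suc A C D)) ⟨
  + (suc A C D) *ℤ 0ℤ ∎
  where p = suc q; open ModReasoning p
lucas {suc q} row zero zero (suc A) (suc D) _ _ = begin
  + (suc (q + A * p) C suc (q + D * p))
    ≡⟨ pascal (q + A * p) (q + D * p) ⟩
  + ((q + A * p) C (q + D * p)) +ℤ + ((q + A * p) C (suc q + D * p))
    ≈⟨ mod-+-cong (lucas row q q A D (n<1+n q) (n<1+n q)) (lucas row q zero A (suc D) (n<1+n q) (s≤s z≤n)) ⟩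
  + (A C D) *ℤ + (q C q) +ℤ + (A C suc D) *ℤ + 1
    ≡⟨ cong (λ c → + (A C D) *ℤ + c +ℤ + (A C suc D) *ℤ + 1) (nCn≡1 q) ⟩
  + (A C D) *ℤ + 1 +ℤ + (A C suc D) *ℤ + 1
    ≡⟨ cong₂ _+ℤ_ (ℤ.*-identityʳ (+ (A C D))) (ℤ.*-identityʳ (+ (A C suc D))) ⟩
  + (A C D) +ℤ + (A C suc D)
    ≡⟨ pascal A D ⟨
  + (suc A C suc D)
    ≡⟨ ℤ.*-identityʳ _ ⟨
  + (suc A C suc D) *ℤ + 1 ∎
  where p = suc q; open ModReasoning p

infixr 5 _∷₃_
_∷₃_ : ℕ → ℕ → ℕ
d ∷₃ x = d + x * 3

ones : ℕ → ℕ
ones zero    = 0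
ones (suc k) = 1 ∷₃ ones k

3^n≡1+ones*2 : ∀ n → 3 ^ n ≡ suc (ones n * 2)
3^n≡1+ones*2 zero    = refl
3^n≡1+ones*2 (suc n) = trans (cong (3 *_) (3^n≡1+ones*2 n)) (identity (ones n))
  where
  identity : ∀ x → 3 * suc (x * 2) ≡ suc ((1 + x * 3) * 2)
  identity = solve-∀

[3^n∸1]/2≡ones : ∀ n → (3 ^ n ∸ 1) / 2 ≡ ones n
[3^n∸1]/2≡ones n rewrite 3^n≡1+ones*2 n = m*n/n≡m (ones n) 2

[3^n+1]/2≡1+ones : ∀ n → (3 ^ n + 1) / 2 ≡ suc (ones n)
[3^n+1]/2≡1+ones n rewrite 3^n≡1+ones*2 n | +-comm (ones n * 2) 1 = m*n/n≡m (suc (ones n)) 2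

idx≡ones : ∀ n j k → idx n j k ≡ suc (ones n) + ones j + ones k
idx≡ones n j k = cong₂ _+_ (cong₂ _+_ ([3^n+1]/2≡1+ones n) ([3^n∸1]/2≡ones j)) ([3^n∸1]/2≡ones k)

idx∸[3^n+1]/2 : ∀ n j k → idx n j k ∸ (3 ^ n + 1) / 2 ≡ ones j + ones k
idx∸[3^n+1]/2 n j k = begin
  idx n j k ∸ (3 ^ n + 1) / 2                    ≡⟨ cong₂ _∸_ (idx≡ones n j k) ([3^n+1]/2≡1+ones n) ⟩
  suc (ones n) + ones j + ones k ∸ suc (ones n)   ≡⟨ cong (_∸ suc (ones n)) (+-assoc (suc (ones n)) (ones j) (ones k)) ⟩
  suc (ones n) + (ones j + ones k) ∸ suc (ones n) ≡⟨ m+n∸m≡n (suc (ones n)) (ones j + ones k) ⟩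
  ones j + ones k                                 ∎
  where open ≡-Reasoning

3*idx∸[3^n∸1]/2 : ∀ n j k → 3 * idx (suc n) j k ∸ (3 ^ suc n ∸ 1) / 2 ≡ 2 ∷₃ (3 ^ n + (ones j + ones k))
3*idx∸[3^n∸1]/2 n j k = begin
  3 * idx (suc n) j k ∸ (3 ^ suc n ∸ 1) / 2
    ≡⟨ cong₂ _∸_ (cong (3 *_) (idx≡ones (suc n) j k)) ([3^n∸1]/2≡ones (suc n)) ⟩
  3 * (suc (ones (suc n)) + ones j + ones k) ∸ ones (suc n)
    ≡⟨ cong (_∸ ones (suc n)) (identity (ones n) (ones j) (ones k)) ⟩
  (2 ∷₃ (suc (ones n * 2) + (ones j + ones k))) + ones (suc n) ∸ ones (suc n)
    ≡⟨ m+n∸n≡m _ (ones (suc n)) ⟩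
  2 ∷₃ (suc (ones n * 2) + (ones j + ones k))
    ≡⟨ cong (λ t → 2 ∷₃ (t + (ones j + ones k))) (3^n≡1+ones*2 n) ⟨
  2 ∷₃ (3 ^ n + (ones j + ones k)) ∎
  where
  open ≡-Reasoning
  identity : ∀ x y z → 3 * (suc (1 + x * 3) + y + z) ≡ (2 + (suc (x * 2) + (y + z)) * 3) + (1 + x * 3)
  identity = solve-∀

3^n≡3^k*3^[n∸k] : ∀ {k n} → k ≤ n → 3 ^ n ≡ 3 ^ k * 3 ^ (n ∸ k)
3^n≡3^k*3^[n∸k] {k} {n} k≤n = trans (cong (3 ^_) (sym (m+[n∸m]≡n k≤n))) (^-distribˡ-+-* 3 k (n ∸ k))

3∣3Ck : ∀ {k} → 0 < k → k < 3 → 3 ℕ.∣ 3 C k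
3∣3Ck {1} _ _ = divides 1 refl
3∣3Ck {2} _ _ = divides 1 refl
3∣3Ck {suc (suc (suc _))} _ (s≤s (s≤s (s≤s ())))

-- One Lucas step keeps the top in the shape c ∷₃ (3^k X + m): the new top digit is the digit d peeled
-- off the bottom.
lucas₃-shift : ∀ k X m {c d} → c < 3 → d < 3 →
  + ((c ∷₃ (3 ^ suc k * X + (d ∷₃ m))) C (d ∷₃ m)) ≈ + ((d ∷₃ (3 ^ k * X + m)) C m) *ℤ + (c C d) [mod 3 ]
lucas₃-shift k X m {c} {d} c<3 d<3 =
  mod-trans (mod-reflexive (cong (λ t → + ((c ∷₃ t) C (d ∷₃ m))) (shift (3 ^ k) X d m)))
            (lucas 3∣3Ck c d (d ∷₃ (3 ^ k * X + m)) m c<3 d<3)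
  where
  shift : ∀ P X d m → 3 * P * X + (d + m * 3) ≡ d + (P * X + m) * 3
  shift = solve-∀

1<3 : 1 < 3
1<3 = s≤s (s≤s z≤n)

2<3 : 2 < 3
2<3 = s≤s (s≤s (s≤s z≤n))

C-ones : ∀ k X → + ((1 ∷₃ (3 ^ k * X + ones k)) C ones k) ≈ + 1 [mod 3 ]
C-ones zero    X = mod-reflexive refl
C-ones (suc k) X = begin
  + ((1 ∷₃ (3 ^ suc k * X + ones (suc k))) C ones (suc k))
    ≈⟨ lucas₃-shift k X (ones k) 1<3 1<3 ⟩
  + ((1 ∷₃ (3 ^ k * X + ones k)) C ones k) *ℤ + 1
    ≡⟨ ℤ.*-identityʳ _ ⟩
  + ((1 ∷₃ (3 ^ k * X + ones k)) C ones k)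
    ≈⟨ C-ones k X ⟩
  + 1 ∎
  where open ModReasoning 3

C-two-ones : ∀ k X → + ((2 ∷₃ (3 ^ suc k * X + ones (suc k))) C ones (suc k)) ≈ + 2 [mod 3 ]
C-two-ones k X = begin
  + ((2 ∷₃ (3 ^ suc k * X + ones (suc k))) C ones (suc k))
    ≈⟨ lucas₃-shift k X (ones k) 2<3 1<3 ⟩
  + ((1 ∷₃ (3 ^ k * X + ones k)) C ones k) *ℤ + 2
    ≡⟨ ℤ.*-comm (+ ((1 ∷₃ (3 ^ k * X + ones k)) C ones k)) (+ 2) ⟩
  + 2 *ℤ + ((1 ∷₃ (3 ^ k * X + ones k)) C ones k)
    ≈⟨ mod-*-congˡ (+ 2) (C-ones k X) ⟩
  + 2 ∎
  where open ModReasoning 3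

C-strip-twos : ∀ j t X →
  + ((2 ∷₃ (3 ^ (j + t) * X + (ones j + ones (j + t)))) C (ones j + ones (j + t)))
    ≈ + ((2 ∷₃ (3 ^ t * X + ones t)) C ones t) [mod 3 ]
C-strip-twos zero    t X = mod-reflexive refl
C-strip-twos (suc j) t X = begin
  + ((2 ∷₃ (3 ^ suc (j + t) * X + S′)) C S′)
    ≡⟨ cong (λ s → + ((2 ∷₃ (3 ^ suc (j + t) * X + s)) C s)) (identity (ones j) (ones (j + t))) ⟩
  + ((2 ∷₃ (3 ^ suc (j + t) * X + (2 ∷₃ S))) C (2 ∷₃ S))
    ≈⟨ lucas₃-shift (j + t) X S 2<3 2<3 ⟩
  + ((2 ∷₃ (3 ^ (j + t) * X + S)) C S) *ℤ + 1
    ≡⟨ ℤ.*-identityʳ _ ⟩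
  + ((2 ∷₃ (3 ^ (j + t) * X + S)) C S)
    ≈⟨ C-strip-twos j t X ⟩
  + ((2 ∷₃ (3 ^ t * X + ones t)) C ones t) ∎
  where
  open ModReasoning 3
  S S′ : ℕ
  S = ones j + ones (j + t)
  S′ = ones (suc j) + ones (suc j + t)
  identity : ∀ x y → (1 + x * 3) + (1 + y * 3) ≡ 2 + (x + y) * 3
  identity = solve-∀

C-reduce-to-ones : ∀ {j k n} t → j + t ≡ k → k ≤ n →
  + ((2 ∷₃ (3 ^ n + (ones j + ones k))) C (ones j + ones k))
    ≈ + ((2 ∷₃ (3 ^ t * 3 ^ (n ∸ k) + ones t)) C ones t) [mod 3 ]
C-reduce-to-ones {j} {n = n} t refl k≤n rewrite 3^n≡3^k*3^[n∸k] k≤n = C-strip-twos j t (3 ^ (n ∸ (j + t)))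

C-diagonal : ∀ {k n} → k ≤ n →
  + ((2 ∷₃ (3 ^ n + (ones k + ones k))) C (ones k + ones k)) ≈ + 1 [mod 3 ]
C-diagonal {k} k≤n = C-reduce-to-ones 0 (+-identityʳ k) k≤n

C-off-diagonal : ∀ {j k n} → j < k → k ≤ n →
  + ((2 ∷₃ (3 ^ n + (ones j + ones k))) C (ones j + ones k)) ≈ + 2 [mod 3 ]
C-off-diagonal {j} {k} {n} j<k k≤n =
  mod-trans (C-reduce-to-ones (suc t) (trans (+-suc j t) (m+[n∸m]≡n j<k)) k≤n) (C-two-ones t (3 ^ (n ∸ k)))
  where t = k ∸ suc j

neg1^-distrib-+ : ∀ m n → neg1^ (m + n) ≡ neg1^ m *ℤ neg1^ n
neg1^-distrib-+ zero    n = sym (ℤ.*-identityˡ (neg1^ n))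
neg1^-distrib-+ (suc m) n = trans (cong -_ (neg1^-distrib-+ m n)) (ℤ.neg-distribˡ-* (neg1^ m) (neg1^ n))

neg1^[n+n]≡1 : ∀ n → neg1^ (n + n) ≡ + 1
neg1^[n+n]≡1 zero    = refl
neg1^[n+n]≡1 (suc n) = begin
  - neg1^ (n + suc n)    ≡⟨ cong (λ i → - neg1^ i) (+-suc n n) ⟩
  - - neg1^ (n + n)      ≡⟨ ℤ.neg-involutive (neg1^ (n + n)) ⟩
  neg1^ (n + n)          ≡⟨ neg1^[n+n]≡1 n ⟩
  + 1                    ∎
  where open ≡-Reasoning

neg1^-ones : ∀ k → neg1^ (ones k) ≡ neg1^ k
neg1^-ones zero    = refl
neg1^-ones (suc k) = cong -_ (begin
  neg1^ (ones k * 3)                          ≡⟨ cong neg1^ (identity (ones k)) ⟩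
  neg1^ (ones k + (ones k + ones k))          ≡⟨ neg1^-distrib-+ (ones k) (ones k + ones k) ⟩
  neg1^ (ones k) *ℤ neg1^ (ones k + ones k)   ≡⟨ cong (neg1^ (ones k) *ℤ_) (neg1^[n+n]≡1 (ones k)) ⟩
  neg1^ (ones k) *ℤ + 1                       ≡⟨ ℤ.*-identityʳ (neg1^ (ones k)) ⟩
  neg1^ (ones k)                              ≡⟨ neg1^-ones k ⟩
  neg1^ k                                     ∎)
  where
  open ≡-Reasoning
  identity : ∀ x → x * 3 ≡ x + (x + x)
  identity = solve-∀

2≈neg1^1 : + 2 ≈ neg1^ 1 [mod 3 ]
2≈neg1^1 = mk≈ (divides 1 refl)

signed-C-diagonal : ∀ {k n} → k ≤ n →
  neg1^ (ones k + ones k) *ℤ + ((2 ∷₃ (3 ^ n + (ones k + ones k))) C (ones k + ones k)) ≈ + 1 [mod 3 ]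
signed-C-diagonal {k} {n} k≤n = begin
  neg1^ (ones k + ones k) *ℤ + B   ≡⟨ cong (_*ℤ + B) (neg1^[n+n]≡1 (ones k)) ⟩
  + 1 *ℤ + B                       ≡⟨ ℤ.*-identityˡ (+ B) ⟩
  + B                              ≈⟨ C-diagonal k≤n ⟩
  + 1                              ∎
  where
  open ModReasoning 3
  B : ℕ
  B = (2 ∷₃ (3 ^ n + (ones k + ones k))) C (ones k + ones k)

signed-C-off-diagonal : ∀ {j k n} → j < k → k ≤ n →
  neg1^ (ones j + ones k) *ℤ + ((2 ∷₃ (3 ^ n + (ones j + ones k))) C (ones j + ones k))
    ≈ neg1^ (j + k + 1) [mod 3 ]
signed-C-off-diagonal {j} {k} {n} j<k k≤n = begin
  neg1^ (ones j + ones k) *ℤ + B          ≈⟨ mod-*-congˡ (neg1^ (ones j + ones k)) (C-off-diagonal j<k k≤n) ⟩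
  neg1^ (ones j + ones k) *ℤ + 2          ≈⟨ mod-*-congˡ (neg1^ (ones j + ones k)) 2≈neg1^1 ⟩
  neg1^ (ones j + ones k) *ℤ neg1^ 1      ≡⟨ cong (_*ℤ neg1^ 1) (neg1^-distrib-+ (ones j) (ones k)) ⟩
  neg1^ (ones j) *ℤ neg1^ (ones k) *ℤ neg1^ 1
    ≡⟨ cong (_*ℤ neg1^ 1) (cong₂ _*ℤ_ (neg1^-ones j) (neg1^-ones k)) ⟩
  neg1^ j *ℤ neg1^ k *ℤ neg1^ 1           ≡⟨ cong (_*ℤ neg1^ 1) (neg1^-distrib-+ j k) ⟨
  neg1^ (j + k) *ℤ neg1^ 1                ≡⟨ neg1^-distrib-+ (j + k) 1 ⟨
  neg1^ (j + k + 1)                       ∎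
  where
  open ModReasoning 3
  B : ℕ
  B = (2 ∷₃ (3 ^ n + (ones j + ones k))) C (ones j + ones k)

theorem6 : (n j k : ℕ) → 1 ≤ n → j ≤ k → k < n →
    ((j ≡ k →
      (neg1^ (idx n j k ∸ (3 ^ n + 1) / 2) *ℤ (+ ((3 * idx n j k ∸ (3 ^ n ∸ 1) / 2) C (idx n j k ∸ (3 ^ n + 1) / 2)))) ≡ + 1 [mod 3 ])
    × (j < k →
      (neg1^ (idx n j k ∸ (3 ^ n + 1) / 2) *ℤ (+ ((3 * idx n j k ∸ (3 ^ n ∸ 1) / 2) C (idx n j k ∸ (3 ^ n + 1) / 2)))) ≡ neg1^ (j + k + 1) [mod 3 ]))
theorem6 (suc n) j k _ _ (s≤s k≤n)
  rewrite idx∸[3^n+1]/2 (suc n) j k | 3*idx∸[3^n∸1]/2 n j k =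
    (λ { refl → ≈⇒≡ (signed-C-diagonal k≤n) }) , λ j<k → ≈⇒≡ (signed-C-off-diagonal j<k k≤n)
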